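{- Let $G$ be an undirected graph, $c:E(G)\to\mathbb{R}_{>0}$, $\mathcal{T}\subseteq V(G)$, $r\in\mathcal{T}$, $L$ a valid lower bound and $U\ge\mathrm{smt}(\mathcal{T})$. Let $v\in V(G)$, $I\subseteq\mathcal{T}\setminus\{r\}$ and let $T_1$ be a tree in $G$ containing $\{v\}\cup I$ with $c(T_1)+L(v,\mathcal{T}\setminus I)>U$. Then there is no optimum Steiner tree for $\mathcal{T}$ containing $T_1$ as a $(v,I)$-subtree.
   Context: $\mathrm{smt}(X)$ is the minimum cost of a tree in $G$ containing $X\subseteq V(G)$; a Steiner tree for $\mathcal{T}$ is a tree containing $\mathcal{T}$, optimum if its cost equals $\mathrm{smt}(\mathcal{T})$. A function $L:V(G)\times 2^{\mathcal{T}}\to\mathbb{R}_{\ge0}$ is a valid lower bound (w.r.t. $r$) if $L(r,\{r\})=0$ and $L(v,I)\le L(w,I')+\mathrm{smt}((I\setminus I')\cup\{v,w\})$ for all $v,w\in V(G)$ and all $\{r\}\subseteq I'\subseteq I\subseteq\mathcal{T}$. For a Steiner tree $T$ for $\mathcal{T}$ and $(v,I)\in V(G)\times2^{\mathcal{T}}$, a tree $T_1$ is a $(v,I)$-subtree of $T$ if there is a tree $T_2$ with $V(T_1)\cup V(T_2)=V(T)$, $V(T_1)\cap V(T_2)=\{v\}$, $T_1$ a subtree of $T$ containing $\{v\}\cup I$, and $T_2$ a subtree of $T$ containing $\{v\}\cup(\mathcal{T}\setminus I)$. -}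

module Defs where

open import Level using (0ℓ)
open import Data.Nat using (ℕ)
open import Data.Bool using (Bool; if_then_else_)
open import Data.Fin using (Fin)
open import Data.Fin.Subset using (Subset; _∈_; _⊆_; _∪_; _∩_; _─_; ⁅_⁆)
open import Data.Vec using (foldr′; zipWith; tabulate)
open import Data.Product using (Σ; ∃; _×_; proj₁; proj₂)
open import Data.Sum using (_⊎_)
open import Data.List using (List; []; _∷_)
open import Data.List.Relation.Unary.Unique.Propositional using (Unique)
open import Relation.Binary.PropositionalEquality using (_≡_; _≢_)
open import Relation.Binary.Structures using (IsTotalOrder)
open import Algebra.Structures using (IsCommutativeMonoid)

-- The paper uses real numbers; the standard library has no
-- reals, so we work over an arbitrary totally ordered commutative monoid
-- whose order is compatible with addition (ℝ with + and ≤ is an instance).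

record OrderedCostMonoid : Set₁ where
  infixl 6 _+_
  infix 4 _≤_
  field
    Carrier : Set
    _+_     : Carrier → Carrier → Carrier
    0#      : Carrier
    _≤_     : Carrier → Carrier → Set
    isCommutativeMonoid : IsCommutativeMonoid {A = Carrier} _≡_ _+_ 0#
    isTotalOrder        : IsTotalOrder {A = Carrier} _≡_ _≤_
    +-mono-≤ : ∀ {a b c d} → a ≤ b → c ≤ d → a + c ≤ b + d

  infix 4 _<_
  _<_ : Carrier → Carrier → Set
  a < b = (a ≤ b) × (a ≢ b)

-- Finite undirected (multi)graphs: vertices Fin n, edges Fin m, each edge
-- with two endpoints.

record Graph : Set where
  field
    n    : ℕ
    m    : ℕ
    ends : Fin m → Fin n × Fin n

module GraphDefs (G : Graph) (K : OrderedCostMonoid) (c : Fin (Graph.m G) → OrderedCostMonoid.Carrier K) where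
  open Graph G
  open OrderedCostMonoid K

  V : Set
  V = Fin n

  E : Set
  E = Fin m

  Joins : E → V → V → Set
  Joins e x y = (proj₁ (ends e) ≡ x × proj₂ (ends e) ≡ y) ⊎ (proj₁ (ends e) ≡ y × proj₂ (ends e) ≡ x)

  data Walk (F : Subset m) : V → V → Set where
    nil  : ∀ {x} → Walk F x x
    cons : ∀ {x z y} (e : E) → e ∈ F → Joins e x z → Walk F z y → Walk F x y

  walkEdges : ∀ {F x y} → Walk F x y → List E
  walkEdges nil = []
  walkEdges (cons e _ _ w) = e ∷ walkEdges w

  record Subgraph : Set where
    field
      vs     : Subset n
      es     : Subset m
      closed : ∀ e → e ∈ es → (proj₁ (ends e) ∈ vs) × (proj₂ (ends e) ∈ vs)
  open Subgraph public

  Connected : Subgraph → Set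
  Connected H = ∀ x y → x ∈ vs H → y ∈ vs H → Walk (es H) x y

  -- no cycle: every closed trail (walk with pairwise distinct edges) is empty
  Acyclic : Subgraph → Set
  Acyclic H = ∀ x (w : Walk (es H) x x) → Unique (walkEdges w) → walkEdges w ≡ []

  IsTree : Subgraph → Set
  IsTree H = (∃ λ x → x ∈ vs H) × Connected H × Acyclic H

  cost : Subgraph → Carrier
  cost H = foldr′ _+_ 0# (zipWith (λ b x → if b then x else 0#) (es H) (tabulate c))

  TreeContaining : Subset n → Subgraph → Set
  TreeContaining X H = IsTree H × X ⊆ vs H

  IsSmt : Subset n → Carrier → Set
  IsSmt X k = (Σ Subgraph λ H → TreeContaining X H × cost H ≡ k)
            × (∀ H → TreeContaining X H → k ≤ cost H)

  OptimumSteinerTree : Subset n → Subgraph → Set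
  OptimumSteinerTree 𝒯 T = TreeContaining 𝒯 T × IsSmt 𝒯 (cost T)

  SubtreeOf : Subgraph → Subgraph → Set
  SubtreeOf H T = IsTree H × vs H ⊆ vs T × es H ⊆ es T

  -- valid lower bound w.r.t. r (L is given on all of V × 2^V, only its
  -- values on subsets of 𝒯 are constrained / used)
  ValidLowerBound : Subset n → V → (V → Subset n → Carrier) → Set
  ValidLowerBound 𝒯 r L =
    (∀ v I → 0# ≤ L v I)
    × (L r ⁅ r ⁆ ≡ 0#)
    × (∀ v w I' I → ⁅ r ⁆ ⊆ I' → I' ⊆ I → I ⊆ 𝒯 →
         ∀ k → IsSmt ((I ─ I') ∪ (⁅ v ⁆ ∪ ⁅ w ⁆)) k → L v I ≤ L w I' + k)

  IsVISubtree : Subset n → Subgraph → V → Subset n → Subgraph → Set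
  IsVISubtree 𝒯 T v I T₁ = Σ Subgraph λ T₂ →
      (vs T₁ ∪ vs T₂ ≡ vs T)
    × (vs T₁ ∩ vs T₂ ≡ ⁅ v ⁆)
    × SubtreeOf T₁ T × (⁅ v ⁆ ∪ I) ⊆ vs T₁
    × SubtreeOf T₂ T × (⁅ v ⁆ ∪ (𝒯 ─ I)) ⊆ vs T₂

-- A (v, I)-subtree T₁ and its complement T₂ meet only in v, so they share no
-- edge (a shared edge would be a loop at v) and c(T₁) + c(T₂) ≤ c(T). The tree T₂
-- contains {v} ∪ (𝒯 ∖ I), hence by validity of L with I' = {r} and L(r, {r}) = 0
-- we get L(v, 𝒯 ∖ I) ≤ smt((𝒯 ∖ I ∖ {r}) ∪ {v, r}) ≤ c(T₂). For an optimum T this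
-- gives c(T₁) + L(v, 𝒯 ∖ I) ≤ c(T) = smt(𝒯) ≤ U, contradicting the hypothesis.
module Submission where

open import Defs
open import Data.Bool using (Bool; true; false; T; if_then_else_)
open import Data.Empty using (⊥-elim)
open import Data.Fin using (Fin; zero; suc)
import Data.Nat as ℕ
open import Data.Fin.Subset using (Subset; _∈_; _∉_; _⊆_; _─_; _∪_; _∩_; ⁅_⁆; Empty)
open import Data.Fin.Subset.Properties
  using (drop-∷-⊆; drop-∷-Empty; x∈⁅x⁆; x∈⁅y⁆⇒x≡y; x∈p∪q⁺; x∈p∪q⁻; x∈p∩q⁺; x∈p∩q⁻; x∈p∧x∉q⇒x∈p─q; p─q⊆p)
open import Data.List.Relation.Unary.All using ([])
open import Data.List.Relation.Unary.AllPairs using ([]; _∷_)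
open import Data.Product using (Σ; ∃; _×_; _,_; proj₁; proj₂)
open import Data.Sum using (_⊎_; inj₁; inj₂)
open import Data.Unit using (tt)
open import Data.Vec using ([]; _∷_; here; there; foldr′; zipWith; tabulate)
open import Function using (_∘_)
open import Relation.Binary.Bundles using (TotalPreorder; TotalOrder)
open import Relation.Binary.PropositionalEquality using (_≡_; refl; sym; cong; subst)
open import Relation.Nullary using (¬_; Dec; yes; no)
open import Relation.Nullary.Decidable using (¬¬-excluded-middle)
open import Relation.Nullary.Negation using (¬¬-map)
open import Relation.Unary using (Pred)
open import Algebra.Bundles using (CommutativeMonoid)
import Algebra.Properties.CommutativeSemigroup as CommutativeSemigroupProperties
import Relation.Binary.Reasoning.PartialOrder as PartialOrderReasoning

x∈p─q⇒x∉q : ∀ {k} {x : Fin k} (p q : Subset k) → x ∈ p ─ q → x ∉ q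
x∈p─q⇒x∉q (true ∷ p) (false ∷ q) here ()
x∈p─q⇒x∉q (_ ∷ p) (_ ∷ q) (there x∈p─q) (there x∈q) = x∈p─q⇒x∉q p q x∈p─q x∈q

p∩q≡⁅y⁆⇒x≡y : ∀ {k} {x y : Fin k} {p q : Subset k} → p ∩ q ≡ ⁅ y ⁆ → x ∈ p → x ∈ q → x ≡ y
p∩q≡⁅y⁆⇒x≡y {y = y} p∩q≡y x∈p x∈q = x∈⁅y⁆⇒x≡y y (subst (_ ∈_) p∩q≡y (x∈p∩q⁺ (x∈p , x∈q)))

module FiniteMinimum {a ℓ₁ ℓ₂} (O : TotalPreorder a ℓ₁ ℓ₂) where
  open TotalPreorder O using (_≲_; total; trans) renaming (Carrier to A; refl to ≲-refl)

  IsMinimumOn : ∀ {p k} → Pred (Subset k) p → (Subset k → A) → Subset k → Set _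
  IsMinimumOn P f s = P s × (∀ t → P t → f s ≲ f t)

  EmptyOrMinimum : ∀ {p k} → Pred (Subset k) p → (Subset k → A) → Set _
  EmptyOrMinimum P f = (∀ s → ¬ P s) ⊎ ∃ (IsMinimumOn P f)

  private
    merge : ∀ {p k} {P : Pred (Subset (ℕ.suc k)) p} {f : Subset (ℕ.suc k) → A} →
            EmptyOrMinimum (P ∘ (true ∷_)) (f ∘ (true ∷_)) →
            EmptyOrMinimum (P ∘ (false ∷_)) (f ∘ (false ∷_)) →
            EmptyOrMinimum P f
    merge (inj₁ none₁) (inj₁ none₀) = inj₁ λ { (true ∷ s) → none₁ s ; (false ∷ s) → none₀ s }
    merge (inj₁ none₁) (inj₂ (s , Ps , min)) =
      inj₂ (false ∷ s , Ps , λ { (true ∷ t) Pt → ⊥-elim (none₁ t Pt) ; (false ∷ t) → min t })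
    merge (inj₂ (s , Ps , min)) (inj₁ none₀) =
      inj₂ (true ∷ s , Ps , λ { (true ∷ t) → min t ; (false ∷ t) Pt → ⊥-elim (none₀ t Pt) })
    merge {f = f} (inj₂ (s₁ , Ps₁ , min₁)) (inj₂ (s₀ , Ps₀ , min₀)) with total (f (true ∷ s₁)) (f (false ∷ s₀))
    ... | inj₁ s₁≲s₀ = inj₂ (true ∷ s₁ , Ps₁ , λ { (true ∷ t) → min₁ t ; (false ∷ t) Pt → trans s₁≲s₀ (min₀ t Pt) })
    ... | inj₂ s₀≲s₁ = inj₂ (false ∷ s₀ , Ps₀ , λ { (true ∷ t) Pt → trans s₀≲s₁ (min₁ t Pt) ; (false ∷ t) → min₀ t })

  ¬¬-emptyOrMinimum : ∀ {p} k (P : Pred (Subset k) p) (f : Subset k → A) → ¬ ¬ EmptyOrMinimum P f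
  ¬¬-emptyOrMinimum ℕ.zero P f = ¬¬-map decide ¬¬-excluded-middle
    where
    decide : Dec (P []) → EmptyOrMinimum P f
    decide (yes P[]) = inj₂ ([] , P[] , λ { [] _ → ≲-refl })
    decide (no ¬P[]) = inj₁ λ { [] → ¬P[] }
  ¬¬-emptyOrMinimum (ℕ.suc k) P f ¬result =
    ¬¬-emptyOrMinimum k (P ∘ (true ∷_)) (f ∘ (true ∷_)) λ m₁ →
    ¬¬-emptyOrMinimum k (P ∘ (false ∷_)) (f ∘ (false ∷_)) λ m₀ → ¬result (merge m₁ m₀)

  ¬¬-minimum : ∀ {p k} {P : Pred (Subset k) p} (f : Subset k → A) {s} → P s → ¬ ¬ ∃ (IsMinimumOn P f)
  ¬¬-minimum {k = k} {P} f Ps ¬min = ¬¬-emptyOrMinimum k P f λ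
    { (inj₁ none) → none _ Ps
    ; (inj₂ min) → ¬min min }

module OrderedCostMonoidProperties (K : OrderedCostMonoid) where
  open OrderedCostMonoid K

  totalOrder : TotalOrder _ _ _
  totalOrder = record { isTotalOrder = isTotalOrder }

  open TotalOrder totalOrder public using (totalPreorder; poset)
    renaming (refl to ≤-refl; reflexive to ≤-reflexive; trans to ≤-trans; antisym to ≤-antisym)
  open PartialOrderReasoning poset public

  commutativeMonoid : CommutativeMonoid _ _
  commutativeMonoid = record { isCommutativeMonoid = isCommutativeMonoid }

  open CommutativeMonoid commutativeMonoid public using (identityˡ; identityʳ)
  open CommutativeSemigroupProperties (CommutativeMonoid.commutativeSemigroup commutativeMonoid) public
    using (interchange)

  select : Bool → Carrier → Carrier
  select b x = if b then x else 0#

  sumOver : ∀ {k} → Subset k → (Fin k → Carrier) → Carrier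
  sumOver s f = foldr′ _+_ 0# (zipWith select s (tabulate f))

  select-+-≤ : ∀ x y z {u} → 0# ≤ u → (T x → T z) → (T y → T z) → ¬ (T x × T y) →
               select x u + select y u ≤ select z u
  select-+-≤ true  true  _     _   _   _   both = ⊥-elim (both (tt , tt))
  select-+-≤ true  false true  _   _   _   _    = ≤-reflexive (identityʳ _)
  select-+-≤ true  false false _   x⇒z _   _    = ⊥-elim (x⇒z tt)
  select-+-≤ false true  true  _   _   _   _    = ≤-reflexive (identityˡ _)
  select-+-≤ false true  false _   _   y⇒z _    = ⊥-elim (y⇒z tt)
  select-+-≤ false false true  0≤u _   _   _    = ≤-trans (≤-reflexive (identityˡ 0#)) 0≤u
  select-+-≤ false false false _   _   _   _    = ≤-reflexive (identityˡ 0#)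

  private
    head-⊆ : ∀ {k x z} {p q : Subset k} → x ∷ p ⊆ z ∷ q → T x → T z
    head-⊆ {x = true} {z = true} _ _ = tt
    head-⊆ {x = true} {z = false} p⊆q _ with p⊆q here
    ... | ()

    head-Empty : ∀ {k x y} {p q : Subset k} → Empty ((x ∷ p) ∩ (y ∷ q)) → ¬ (T x × T y)
    head-Empty {x = true} {y = true} empty _ = empty (zero , here)

  sumOver-disjoint-≤ : ∀ {k} {p q r : Subset k} (f : Fin k → Carrier) → (∀ i → 0# ≤ f i) →
                       p ⊆ r → q ⊆ r → Empty (p ∩ q) → sumOver p f + sumOver q f ≤ sumOver r f
  sumOver-disjoint-≤ {p = []} {[]} {[]} _ _ _ _ _ = ≤-reflexive (identityˡ 0#)
  sumOver-disjoint-≤ {p = x ∷ p} {y ∷ q} {z ∷ r} f f≥0 p⊆r q⊆r disjoint = begin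
    (select x (f zero) + sumOver p (f ∘ suc)) + (select y (f zero) + sumOver q (f ∘ suc))
      ≡⟨ interchange _ _ _ _ ⟩
    (select x (f zero) + select y (f zero)) + (sumOver p (f ∘ suc) + sumOver q (f ∘ suc))
      ≤⟨ +-mono-≤ (select-+-≤ x y z (f≥0 zero) (head-⊆ p⊆r) (head-⊆ q⊆r) (head-Empty disjoint))
                  (sumOver-disjoint-≤ (f ∘ suc) (f≥0 ∘ suc) (drop-∷-⊆ p⊆r) (drop-∷-⊆ q⊆r) (drop-∷-Empty disjoint)) ⟩
    select z (f zero) + sumOver r (f ∘ suc) ∎

module SteinerTreeProperties (G : Graph) (K : OrderedCostMonoid) (c : Fin (Graph.m G) → OrderedCostMonoid.Carrier K) where
  open Graph G
  open OrderedCostMonoid K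
  open OrderedCostMonoidProperties K
  open FiniteMinimum totalPreorder
  open GraphDefs G K c

  isSmt-unique : ∀ {X k k′} → IsSmt X k → IsSmt X k′ → k ≡ k′
  isSmt-unique ((H , H∋X , refl) , k-min) ((H′ , H′∋X , refl) , k′-min) =
    ≤-antisym (k-min H′ H′∋X) (k′-min H H∋X)

  -- The cost of a subgraph depends only on its edge set, so it suffices to minimise
  -- over the finitely many edge sets; since carrying a tree is not decidable, the
  -- minimum only exists up to double negation, which is enough to refute.
  ¬¬-isSmt : ∀ {X H} → TreeContaining X H → ¬ ¬ ∃ (IsSmt X)
  ¬¬-isSmt {X} {H} H∋X = ¬¬-map toSmt (¬¬-minimum (λ s → sumOver s c) (H , refl , H∋X))
    where
    EdgeSetOfTree : Subset m → Set
    EdgeSetOfTree s = Σ Subgraph λ H → es H ≡ s × TreeContaining X H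

    toSmt : ∃ (IsMinimumOn EdgeSetOfTree (λ s → sumOver s c)) → ∃ (IsSmt X)
    toSmt (_ , (H₀ , refl , H₀∋X) , min) =
      cost H₀ , (H₀ , H₀∋X , refl) , λ H H∋X → min (es H) (H , refl , H∋X)

  validLowerBound⇒≤cost : ∀ {𝒯 r L J v H} → ValidLowerBound 𝒯 r L → r ∈ J → J ⊆ 𝒯 →
                          TreeContaining (⁅ v ⁆ ∪ J) H → ¬ ¬ (L v J ≤ cost H)
  validLowerBound⇒≤cost {𝒯} {r} {L} {J} {v} {H} (_ , L[r,r]≡0 , L-valid) r∈J J⊆𝒯 (H-tree , v∪J⊆H) =
    ¬¬-map bound (¬¬-isSmt {X} {H} (H-tree , X⊆H))
    where
    X : Subset n
    X = (J ─ ⁅ r ⁆) ∪ (⁅ v ⁆ ∪ ⁅ r ⁆)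

    r⊆J : ⁅ r ⁆ ⊆ J
    r⊆J x∈r = subst (_∈ J) (sym (x∈⁅y⁆⇒x≡y r x∈r)) r∈J

    X⊆H : X ⊆ vs H
    X⊆H x∈X with x∈p∪q⁻ (J ─ ⁅ r ⁆) _ x∈X
    ... | inj₁ x∈J─r = v∪J⊆H (x∈p∪q⁺ (inj₂ (p─q⊆p J ⁅ r ⁆ x∈J─r)))
    ... | inj₂ x∈v∪r with x∈p∪q⁻ ⁅ v ⁆ ⁅ r ⁆ x∈v∪r
    ...   | inj₁ x∈v = v∪J⊆H (x∈p∪q⁺ (inj₁ x∈v))
    ...   | inj₂ x∈r = v∪J⊆H (x∈p∪q⁺ (inj₂ (r⊆J x∈r)))

    bound : ∃ (IsSmt X) → L v J ≤ cost H
    bound (k , k-smt) = begin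
      L v J          ≤⟨ L-valid v r ⁅ r ⁆ J (λ x∈r → x∈r) r⊆J J⊆𝒯 k k-smt ⟩
      L r ⁅ r ⁆ + k  ≡⟨ cong (_+ k) L[r,r]≡0 ⟩
      0# + k         ≡⟨ identityˡ k ⟩
      k              ≤⟨ proj₂ k-smt H (H-tree , X⊆H) ⟩
      cost H         ∎

  -- Both ends of a shared edge lie in vs T₁ ∩ vs T₂ = {v}, so it is a loop at v:
  -- a one-edge closed trail in T₁.
  acyclic-∩-singleton⇒edge-disjoint : ∀ {T₁ T₂ v} → Acyclic T₁ → vs T₁ ∩ vs T₂ ≡ ⁅ v ⁆ →
                                      Empty (es T₁ ∩ es T₂)
  acyclic-∩-singleton⇒edge-disjoint {T₁} {T₂} {v} acyclic T₁∩T₂≡v (e , e∈T₁∩T₂)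
    with e∈T₁ , e∈T₂ ← x∈p∩q⁻ (es T₁) (es T₂) e∈T₁∩T₂
    with (x∈T₁ , y∈T₁) , (x∈T₂ , y∈T₂) ← closed T₁ e e∈T₁ , closed T₂ e e∈T₂
    with () ← acyclic v (cons e e∈T₁ (inj₁ ( p∩q≡⁅y⁆⇒x≡y T₁∩T₂≡v x∈T₁ x∈T₂
                                           , p∩q≡⁅y⁆⇒x≡y T₁∩T₂≡v y∈T₁ y∈T₂)) nil)
                        ([] ∷ [])

lemma5 : (K : OrderedCostMonoid) (G : Graph) (c : Fin (Graph.m G) → OrderedCostMonoid.Carrier K) →
    (∀ e → OrderedCostMonoid._<_ K (OrderedCostMonoid.0# K) (c e)) →
    let open OrderedCostMonoid K in let open GraphDefs G K c in
    (𝒯 : Subset (Graph.n G)) (r : V) → r ∈ 𝒯 →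
    (L : V → Subset (Graph.n G) → Carrier) → ValidLowerBound 𝒯 r L →
    (U : Carrier) → (∃ λ k → IsSmt 𝒯 k × k ≤ U) →
    (v : V) (I : Subset (Graph.n G)) → I ⊆ (𝒯 ─ ⁅ r ⁆) →
    (T₁ : Subgraph) → TreeContaining (⁅ v ⁆ ∪ I) T₁ →
    U < cost T₁ + L v (𝒯 ─ I) →
    ¬ (Σ Subgraph λ T → OptimumSteinerTree 𝒯 T × IsVISubtree 𝒯 T v I T₁)
lemma5 K G c c>0 𝒯 r r∈𝒯 L L-valid U (k , k-smt , k≤U) v I I⊆𝒯─r T₁ _ U<T₁+L
       (T , (_ , T-smt) , T₂ , _ , T₁∩T₂≡v , (T₁-tree , _ , T₁⊆T) , _ , (T₂-tree , _ , T₂⊆T) , v∪𝒯─I⊆T₂) =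
  validLowerBound⇒≤cost {H = T₂} L-valid r∈𝒯─I (p─q⊆p 𝒯 I) (T₂-tree , v∪𝒯─I⊆T₂) λ L≤T₂ →
    begin-contradiction
      U                      <⟨ U<T₁+L ⟩
      cost T₁ + L v (𝒯 ─ I)  ≤⟨ +-mono-≤ ≤-refl L≤T₂ ⟩
      cost T₁ + cost T₂      ≤⟨ sumOver-disjoint-≤ c (proj₁ ∘ c>0) T₁⊆T T₂⊆T T₁∩T₂=∅ ⟩
      cost T                 ≡⟨ isSmt-unique T-smt k-smt ⟩
      k                      ≤⟨ k≤U ⟩
      U                      ∎
  where
  open OrderedCostMonoid K
  open OrderedCostMonoidProperties K
  open GraphDefs G K c
  open SteinerTreeProperties G K c

  r∈𝒯─I : r ∈ 𝒯 ─ I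
  r∈𝒯─I = x∈p∧x∉q⇒x∈p─q r∈𝒯 λ r∈I → x∈p─q⇒x∉q 𝒯 ⁅ r ⁆ (I⊆𝒯─r r∈I) (x∈⁅x⁆ r)

  T₁∩T₂=∅ : Empty (es T₁ ∩ es T₂)
  T₁∩T₂=∅ = acyclic-∩-singleton⇒edge-disjoint {T₁} {T₂} (proj₂ (proj₂ T₁-tree)) T₁∩T₂≡v
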